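{- Let $K,L$ be finite simplicial complexes. If $K$ collapses onto $L$, then $\Gamma(K)\searrow^{s}\Gamma(L)$, i.e. $\Gamma(L)$ is obtained from $\Gamma(K)$ by successive deletions of s-dismantlable vertices.
   Context: An elementary collapse of a simplicial complex removes a pair $(\sigma,\tau)$ of simplices with $\tau\subset\sigma$, $|\tau|=|\sigma|-1$, and $\sigma$ the only simplex properly containing $\tau$; $K$ collapses onto $L$ if $L$ is obtained from $K$ by a finite sequence of elementary collapses. $\Gamma(K)$ is the graph whose vertices are the nonempty simplices of $K$, with two distinct simplices adjacent iff one contains the other. For a graph $G$: $N_G(g)$ is the set of neighbours, $N_G[g]=N_G(g)\cup\{g\}$, vertex sets are identified with induced subgraphs; $g$ is dominated by $g'\ne g$ if $N_G[g]\subseteq N_G[g']$; a graph is dismantlable if it has one vertex or its vertices can be listed $g_1,\dots,g_n$ with each $g_i$ ($2\le i\le n$) dominated by another vertex in the subgraph induced by $\{g_1,\dots,g_i\}$; $g$ is s-dismantlable in $G$ if $N_G(g)$ is dismantlable; $G\searrow^s H$ means $H$ is obtained from $G$ by successive deletions of vertices each s-dismantlable in the current graph. -}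

module Defs where

open import Data.Nat using (ℕ; zero; suc; _+_)
open import Data.Fin using (Fin)
import Data.Fin
open import Data.Fin.Subset as FS using (Subset; Nonempty; ∣_∣; _⊂_)
open import Data.List using (List; []; _∷_; length; take; lookup)
open import Data.List.Membership.Propositional using () renaming (_∈_ to _∈ₗ_)
open import Data.List.Relation.Unary.Unique.Propositional using (Unique)
open import Data.Product using (Σ; ∃; _×_; _,_)
open import Data.Sum using (_⊎_)
open import Relation.Nullary using (¬_; Dec)
open import Relation.Unary using (Pred; Decidable)
open import Relation.Binary.PropositionalEquality using (_≡_; _≢_)
open import Function.Bundles using (_⇔_)

-- We fix an ambient vertex type U with an adjacency relation
-- Adj; a graph is a (finite) vertex set, i.e. a predicate on U, taken
-- with the induced adjacency (vertex sets = induced subgraphs).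

module Graphs {U : Set} (Adj : U → U → Set) where

  Graph : Set₁
  Graph = Pred U _

  InClosedNbhd : U → U → Set
  InClosedNbhd g h = h ≡ g ⊎ Adj g h

  N : Graph → U → Graph
  N G g h = G h × Adj g h

  DominatedBy : Graph → U → U → Set
  DominatedBy G g g' =
    G g' × g' ≢ g × (∀ h → G h → InClosedNbhd g h → InClosedNbhd g' h)

  Prefix : (gs : List U) → ℕ → Graph
  Prefix gs i h = h ∈ₗ take i gs

  -- G is dismantlable: its vertices can be listed g₁,…,gₙ (n ≥ 1,
  -- without repetition) such that each gᵢ (2 ≤ i ≤ n) is dominated by
  -- another vertex in the subgraph induced by {g₁,…,gᵢ}.
  -- (n = 1 is the one-vertex case.)  Index i : Fin (length gs) is 0-based.
  Dismantlable : Graph → Set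
  Dismantlable G =
    Σ (List U) λ gs →
      Unique gs ×
      (∀ h → (h ∈ₗ gs) ⇔ G h) ×
      (gs ≢ []) ×
      (∀ (i : Fin (length gs)) → Data.Fin.toℕ i ≢ 0 →
         ∃ λ g' → DominatedBy (Prefix gs (suc (Data.Fin.toℕ i))) (lookup gs i) g')

  SDismantlable : Graph → U → Set
  SDismantlable G g = Dismantlable (N G g)

  _∖_ : Graph → U → Graph
  (G ∖ g) h = G h × h ≢ g

  data _↘ˢ_ : Graph → Graph → Set₁ where
    done : ∀ {G H} → (∀ h → G h ⇔ H h) → G ↘ˢ H
    step : ∀ {G H} (g : U) → G g → SDismantlable G g → (G ∖ g) ↘ˢ H → G ↘ˢ H

record SimplicialComplex (n : ℕ) : Set₁ where
  field
    simplex      : Subset n → Set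
    simplex?     : Decidable simplex
    nonempty     : ∀ {σ} → simplex σ → Nonempty σ
    down-closed  : ∀ {σ τ} → simplex σ → τ FS.⊆ σ → Nonempty τ → simplex τ
open SimplicialComplex public

ElementaryCollapse : ∀ {n} → Pred (Subset n) _ → Pred (Subset n) _ → Set
ElementaryCollapse {n} K K' =
  Σ (Subset n) λ σ → Σ (Subset n) λ τ →
    K σ × K τ × τ FS.⊆ σ × ∣ τ ∣ + 1 ≡ ∣ σ ∣ ×
    (∀ ρ → K ρ → τ ⊂ ρ → ρ ≡ σ) ×
    (∀ ρ → K' ρ ⇔ (K ρ × ρ ≢ σ × ρ ≢ τ))

data CollapsesP {n} : Pred (Subset n) _ → Pred (Subset n) _ → Set₁ where
  done : ∀ {K L} → (∀ ρ → K ρ ⇔ L ρ) → CollapsesP K L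
  step : ∀ {K K' L} → ElementaryCollapse K K' → CollapsesP K' L → CollapsesP K L

_Collapses-onto_ : ∀ {n} → SimplicialComplex n → SimplicialComplex n → Set₁
K Collapses-onto L = CollapsesP (simplex K) (simplex L)

ΓAdj : ∀ {n} → Subset n → Subset n → Set
ΓAdj σ τ = σ ≢ τ × (σ FS.⊆ τ ⊎ τ FS.⊆ σ)

Γ : ∀ {n} → SimplicialComplex n → Pred (Subset n) _
Γ K = simplex K

module ΓGraphs (n : ℕ) = Graphs {Subset n} ΓAdj

-- Collapse the pair (σ, τ) by deleting τ first and then σ.  In Γ(K) the
-- neighbours of the free face τ are its faces and σ, so N(τ) is a cone with
-- apex σ.  After τ is gone, the neighbours of σ = τ ∪ {v} are the nonempty
-- proper faces of σ other than τ.  Those containing v form a cone with apex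
-- {v}; every other face h is a face of τ and is dominated by h ∪ {v}, so they
-- can be added back in order of increasing size, each one dominated at the
-- moment it is added.
module Submission where

open import Defs

open import Data.Bool using () renaming (_≟_ to _≟ᵇ_)
open import Data.Empty using (⊥-elim)
open import Data.Fin using (Fin; toℕ)
import Data.Fin as Fin
open import Data.Fin.Subset
  using (Subset; Nonempty; ∣_∣; _⊂_; _⊆_; _∈_; _∉_; _∪_; ⁅_⁆; inside; outside)
open import Data.Fin.Subset.Properties
  using ( _⊆?_; _∈?_; nonempty?; ⊆-trans; ⊆-antisym; drop-∷-⊆; in⊂in; out⊂; out⊂in; ⊂-⊆-trans
        ; p⊆p∪q; q⊆p∪q; x∈p∪q⁻; x∈⁅x⁆; x∈⁅y⁆⇒x≡y; p⊂q⇒∣p∣<∣q∣; ∣p∣≤n)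
open import Data.List using (List; []; _∷_; [_]; _++_; _∷ʳ_; length; take; lookup; map)
open import Data.List.Membership.Propositional using () renaming (_∈_ to _∈ₗ_; _∉_ to _∉ₗ_)
open import Data.List.Membership.Propositional.Properties using (∈-++⁺ˡ; ∈-++⁺ʳ; ∈-++⁻; ∈-map⁺)
open import Data.List.Relation.Unary.All as All using ()
open import Data.List.Relation.Unary.AllPairs as AllPairs using ()
open import Data.List.Relation.Unary.Any using (here; there)
open import Data.List.Relation.Unary.Unique.Propositional using (Unique)
open import Data.List.Relation.Unary.Unique.Propositional.Properties using (++⁺)
open import Data.Nat using (ℕ; zero; suc; _+_; _<_; _<?_; s≤s)
open import Data.Nat.Properties using (m+1+n≢m; <-≤-trans; m<n⇒m<1+n)
open import Data.Product using (∃; _×_; _,_; proj₁; proj₂; map₁)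
import Data.Product as Product
open import Data.Sum using (_⊎_; inj₁; inj₂)
import Data.Sum as Sum
open import Data.Vec using ([]; _∷_; here)
open import Data.Vec.Properties using (≡-dec)
open import Function using (_∘_)
open import Function.Bundles using (_⇔_; mk⇔; Equivalence)
import Function.Properties.Equivalence as ⇔
open import Relation.Binary.Definitions using (DecidableEquality)
open import Relation.Binary.PropositionalEquality using (_≡_; _≢_; refl; sym; cong; subst; ≢-sym)
open import Relation.Nullary using (¬_; yes; no)
open import Relation.Nullary.Decidable using (_×-dec_; _⊎-dec_; ¬?; map′)
open import Relation.Unary using (Decidable) renaming (_⊆_ to _⊆ᵤ_)

open Equivalence using (to; from)

lookup-take-∷ʳ : ∀ {A : Set} (xs : List A) y (i : Fin (length (xs ∷ʳ y))) →
  (∃ λ j → toℕ j ≡ toℕ i × lookup (xs ∷ʳ y) i ≡ lookup xs j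
         × take (suc (toℕ i)) (xs ∷ʳ y) ≡ take (suc (toℕ i)) xs)
  ⊎ (lookup (xs ∷ʳ y) i ≡ y × take (suc (toℕ i)) (xs ∷ʳ y) ≡ xs ∷ʳ y)
lookup-take-∷ʳ []       y Fin.zero    = inj₂ (refl , refl)
lookup-take-∷ʳ (x ∷ xs) y Fin.zero    = inj₁ (Fin.zero , refl , refl , refl)
lookup-take-∷ʳ (x ∷ xs) y (Fin.suc i) with lookup-take-∷ʳ xs y i
... | inj₁ (j , j≡i , lookup≡ , take≡) = inj₁ (Fin.suc j , cong suc j≡i , lookup≡ , cong (x ∷_) take≡)
... | inj₂ (lookup≡ , take≡)           = inj₂ (lookup≡ , cong (x ∷_) take≡)

module Dismantling {U : Set} (Adj : U → U → Set) (_≟_ : DecidableEquality U)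
                   (elements : List U) (∈-elements : ∀ u → u ∈ₗ elements) where

  open Graphs Adj

  infix 4 _≃_
  _≃_ : Graph → Graph → Set
  G ≃ H = ∀ h → G h ⇔ H h

  ≃-sym : ∀ {G H} → G ≃ H → H ≃ G
  ≃-sym G≃H h = ⇔.sym (G≃H h)

  ∖-cong : ∀ {G H} g → G ≃ H → G ∖ g ≃ H ∖ g
  ∖-cong g G≃H h = mk⇔ (map₁ (to (G≃H h))) (map₁ (from (G≃H h)))

  N-cong : ∀ {G H} g → G ≃ H → N G g ≃ N H g
  N-cong g G≃H h = mk⇔ (map₁ (to (G≃H h))) (map₁ (from (G≃H h)))

  ∖? : ∀ {G} → Decidable G → ∀ g → Decidable (G ∖ g)
  ∖? G? g h = G? h ×-dec ¬? (h ≟ g)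

  DominatedBy-cong : ∀ {G H g g'} → G ≃ H → DominatedBy G g g' → DominatedBy H g g'
  DominatedBy-cong G≃H (Gg' , g'≢g , N[g]⊆N[g']) =
    to (G≃H _) Gg' , g'≢g , λ h Hh → N[g]⊆N[g'] h (from (G≃H h) Hh)

  Dismantlable-cong : ∀ {G H} → G ≃ H → Dismantlable G → Dismantlable H
  Dismantlable-cong G≃H (gs , unique , ∈gs⇔ , gs≢[] , dominated) =
    gs , unique , (λ h → ⇔.trans (∈gs⇔ h) (G≃H h)) , gs≢[] , dominated

  singleton-dismantlable : ∀ a → Dismantlable (_≡ a)
  singleton-dismantlable a =
    [ a ] , All.[] AllPairs.∷ AllPairs.[] ,
    (λ h → mk⇔ (λ { (here h≡a) → h≡a ; (there ()) }) here) , (λ ()) ,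
    λ { Fin.zero 0≢0 → ⊥-elim (0≢0 refl) }

  dismantlable-extend : ∀ {G g g'} → G g → DominatedBy G g g' → Dismantlable (G ∖ g) → Dismantlable G
  dismantlable-extend {G} {g} {g'} Gg g-dominated (gs , unique , ∈gs⇔ , gs≢[] , dominated) =
    gs ∷ʳ g , unique′ , ∈gs∷ʳg⇔ , gs∷ʳg≢[] gs , dominated′
    where
      g∉gs : g ∉ₗ gs
      g∉gs g∈gs = proj₂ (to (∈gs⇔ g) g∈gs) refl

      unique′ : Unique (gs ∷ʳ g)
      unique′ = ++⁺ unique (All.[] AllPairs.∷ AllPairs.[]) λ { (g∈gs , here refl) → g∉gs g∈gs }

      ∈gs∷ʳg⇔ : ∀ h → (h ∈ₗ gs ∷ʳ g) ⇔ G h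
      ∈gs∷ʳg⇔ h = mk⇔ ∈⇒ ⇒∈
        where
          ∈⇒ : h ∈ₗ gs ∷ʳ g → G h
          ∈⇒ h∈ with ∈-++⁻ gs h∈
          ... | inj₁ h∈gs        = proj₁ (to (∈gs⇔ h) h∈gs)
          ... | inj₂ (here refl) = Gg
          ⇒∈ : G h → h ∈ₗ gs ∷ʳ g
          ⇒∈ Gh with h ≟ g
          ... | yes refl = ∈-++⁺ʳ gs (here refl)
          ... | no h≢g   = ∈-++⁺ˡ (from (∈gs⇔ h) (Gh , h≢g))

      gs∷ʳg≢[] : ∀ xs → xs ∷ʳ g ≢ []
      gs∷ʳg≢[] []      ()
      gs∷ʳg≢[] (_ ∷ _) ()

      dominated′ : ∀ i → toℕ i ≢ 0 →
        ∃ λ g'' → DominatedBy (Prefix (gs ∷ʳ g) (suc (toℕ i))) (lookup (gs ∷ʳ g) i) g''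
      dominated′ i i≢0 with lookup-take-∷ʳ gs g i
      ... | inj₁ (j , j≡i , lookup≡ , take≡) rewrite lookup≡ | take≡ | sym j≡i = dominated j i≢0
      ... | inj₂ (lookup≡ , take≡) rewrite lookup≡ | take≡ =
        g' , DominatedBy-cong (≃-sym ∈gs∷ʳg⇔) g-dominated

  StablyDominated : Graph → Graph → Set₁
  StablyDominated H G = ∀ M {h} → H ⊆ᵤ M → M ⊆ᵤ G → M h → ¬ H h → ∃ (DominatedBy M h)

  private
    fill-along : ∀ (xs : List U) {H G} → Decidable H → Decidable G → H ⊆ᵤ G →
      (∀ h → G h → ¬ H h → h ∈ₗ xs) → StablyDominated H G → Dismantlable H → Dismantlable G
    fill-along [] {H} {G} H? G? H⊆G covered _ H-dismantlable =
      Dismantlable-cong (λ h → mk⇔ H⊆G (G⊆H h)) H-dismantlable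
      where
        G⊆H : ∀ h → G h → H h
        G⊆H h Gh with H? h
        ... | yes Hh = Hh
        ... | no ¬Hh with () ← covered h Gh ¬Hh
    fill-along (x ∷ xs) {H} {G} H? G? H⊆G covered stable H-dismantlable with G? x ×-dec ¬? (H? x)
    ... | yes (Gx , ¬Hx) =
      dismantlable-extend Gx (proj₂ (stable G H⊆G (λ Gh → Gh) Gx ¬Hx))
        (fill-along xs H? (∖? G? x) (λ Hh → H⊆G Hh , λ { refl → ¬Hx Hh }) covered′
           (λ M H⊆M M⊆G∖x → stable M H⊆M (proj₁ ∘ M⊆G∖x)) H-dismantlable)
      where
        covered′ : ∀ h → (G ∖ x) h → ¬ H h → h ∈ₗ xs
        covered′ h (Gh , h≢x) ¬Hh with covered h Gh ¬Hh
        ... | here h≡x   = ⊥-elim (h≢x h≡x)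
        ... | there h∈xs = h∈xs
    ... | no ¬new = fill-along xs H? G? H⊆G covered′ stable H-dismantlable
      where
        covered′ : ∀ h → G h → ¬ H h → h ∈ₗ xs
        covered′ h Gh ¬Hh with covered h Gh ¬Hh
        ... | here refl  = ⊥-elim (¬new (Gh , ¬Hh))
        ... | there h∈xs = h∈xs

  fill-dismantlable : ∀ {H G} → Decidable H → Decidable G → H ⊆ᵤ G →
    StablyDominated H G → Dismantlable H → Dismantlable G
  fill-dismantlable H? G? H⊆G = fill-along elements H? G? H⊆G (λ h _ _ → ∈-elements h)

  cone-dismantlable : ∀ {G a} → Decidable G → G a → (∀ h → G h → h ≢ a → Adj a h) → Dismantlable G
  cone-dismantlable {G} {a} G? Ga apex =
    fill-dismantlable (_≟ a) G? (λ { refl → Ga }) dominated-by-apex (singleton-dismantlable a)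
    where
      dominated-by-apex : StablyDominated (_≡ a) G
      dominated-by-apex M a∈M M⊆G Mh h≢a = a , a∈M refl , ≢-sym h≢a , λ x Mx _ → N[a] x Mx
        where
          N[a] : ∀ x → M x → x ≡ a ⊎ Adj a x
          N[a] x Mx with x ≟ a
          ... | yes x≡a = inj₁ x≡a
          ... | no x≢a  = inj₂ (apex x (M⊆G Mx) x≢a)

  ↘ˢ-congˡ : ∀ {G G' H} → G ≃ G' → G' ↘ˢ H → G ↘ˢ H
  ↘ˢ-congˡ G≃G' (done G'≃H) = done (λ h → ⇔.trans (G≃G' h) (G'≃H h))
  ↘ˢ-congˡ G≃G' (step g G'g g-removable rest) =
    step g (from (G≃G' g) G'g) (Dismantlable-cong (N-cong g (≃-sym G≃G')) g-removable)
      (↘ˢ-congˡ (∖-cong g G≃G') rest)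

subsets : ∀ n → List (Subset n)
subsets zero    = [ [] ]
subsets (suc n) = map (inside ∷_) (subsets n) ++ map (outside ∷_) (subsets n)

∈-subsets : ∀ {n} (p : Subset n) → p ∈ₗ subsets n
∈-subsets []                    = here refl
∈-subsets {suc n} (inside ∷ p)  = ∈-++⁺ˡ (∈-map⁺ (inside ∷_) (∈-subsets p))
∈-subsets {suc n} (outside ∷ p) = ∈-++⁺ʳ (map (inside ∷_) (subsets n)) (∈-map⁺ (outside ∷_) (∈-subsets p))

⊆∧≢⇒⊂ : ∀ {n} {p q : Subset n} → p ⊆ q → p ≢ q → p ⊂ q
⊆∧≢⇒⊂ {p = []}          {[]}          _   p≢q = ⊥-elim (p≢q refl)
⊆∧≢⇒⊂ {p = inside ∷ p}  {inside ∷ q}  p⊆q p≢q = in⊂in (⊆∧≢⇒⊂ (drop-∷-⊆ p⊆q) (p≢q ∘ cong (inside ∷_)))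
⊆∧≢⇒⊂ {p = inside ∷ p}  {outside ∷ q} p⊆q _   with () ← p⊆q here
⊆∧≢⇒⊂ {p = outside ∷ p} {inside ∷ q}  p⊆q _   = out⊂in (drop-∷-⊆ p⊆q)
⊆∧≢⇒⊂ {p = outside ∷ p} {outside ∷ q} p⊆q p≢q = out⊂ (⊆∧≢⇒⊂ (drop-∷-⊆ p⊆q) (p≢q ∘ cong (outside ∷_)))

x∈p⇒⁅x⁆⊆p : ∀ {n} {p : Subset n} {x} → x ∈ p → ⁅ x ⁆ ⊆ p
x∈p⇒⁅x⁆⊆p {x = x} x∈p y∈⁅x⁆ = subst (_∈ _) (sym (x∈⁅y⁆⇒x≡y x y∈⁅x⁆)) x∈p

∪⁅⁆-least : ∀ {n} {p q : Subset n} {x} → p ⊆ q → x ∈ q → p ∪ ⁅ x ⁆ ⊆ q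
∪⁅⁆-least {p = p} {x = x} p⊆q x∈q y∈ with x∈p∪q⁻ p ⁅ x ⁆ y∈
... | inj₁ y∈p   = p⊆q y∈p
... | inj₂ y∈⁅x⁆ = x∈p⇒⁅x⁆⊆p x∈q y∈⁅x⁆

⊆-∪⁅⁆-cancel : ∀ {n} {p q : Subset n} {x} → p ⊆ q ∪ ⁅ x ⁆ → x ∉ p → p ⊆ q
⊆-∪⁅⁆-cancel {q = q} {x} p⊆q∪x x∉p {y} y∈p with x∈p∪q⁻ q ⁅ x ⁆ (p⊆q∪x y∈p)
... | inj₁ y∈q = y∈q
... | inj₂ y∈⁅x⁆ = ⊥-elim (x∉p (subst (_∈ _) (x∈⁅y⁆⇒x≡y x y∈⁅x⁆) y∈p))

module _ {n : ℕ} where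

  _≟_ : DecidableEquality (Subset n)
  _≟_ = ≡-dec _≟ᵇ_

  open Graphs {Subset n} ΓAdj
  open Dismantling ΓAdj _≟_ (subsets n) ∈-subsets

  ΓAdj? : ∀ σ → Decidable (ΓAdj σ)
  ΓAdj? σ ρ = ¬? (σ ≟ ρ) ×-dec (σ ⊆? ρ ⊎-dec ρ ⊆? σ)

  N-free-face-dismantlable : ∀ {K : Graph} {σ τ} → Decidable K → K σ → τ ⊆ σ → τ ≢ σ →
    (∀ ρ → K ρ → τ ⊂ ρ → ρ ≡ σ) → Dismantlable (N K τ)
  N-free-face-dismantlable {K} {σ} {τ} K? Kσ τ⊆σ τ≢σ only-σ =
    cone-dismantlable (λ h → K? h ×-dec ΓAdj? τ h) (Kσ , τ≢σ , inj₁ τ⊆σ) apex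
    where
      apex : ∀ h → N K τ h → h ≢ σ → ΓAdj σ h
      apex h (Kh , τ≢h , inj₁ τ⊆h) h≢σ = ⊥-elim (h≢σ (only-σ h Kh (⊆∧≢⇒⊂ τ⊆h τ≢h)))
      apex h (Kh , τ≢h , inj₂ h⊆τ) h≢σ = ≢-sym h≢σ , inj₂ (⊆-trans h⊆τ τ⊆σ)

  BoundaryMinus : Subset n → Subset n → Graph
  BoundaryMinus σ τ h = Nonempty h × h ⊆ σ × h ≢ σ × h ≢ τ

  BoundaryMinus? : ∀ σ τ → Decidable (BoundaryMinus σ τ)
  BoundaryMinus? σ τ h = nonempty? h ×-dec h ⊆? σ ×-dec ¬? (h ≟ σ) ×-dec ¬? (h ≟ τ)

  module _ {τ : Subset n} {v : Fin n} (τ-nonempty : Nonempty τ) (v∉τ : v ∉ τ) where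

    private
      σ : Subset n
      σ = τ ∪ ⁅ v ⁆

      v∈σ : v ∈ σ
      v∈σ = q⊆p∪q τ ⁅ v ⁆ (x∈⁅x⁆ v)

      Stratum : ℕ → Graph
      Stratum k h = BoundaryMinus σ τ h × (v ∈ h ⊎ ∣ h ∣ < k)

      Stratum? : ∀ k → Decidable (Stratum k)
      Stratum? k h = BoundaryMinus? σ τ h ×-dec (v ∈? h ⊎-dec ∣ h ∣ <? k)

      ⁅v⁆∈Stratum₀ : Stratum 0 ⁅ v ⁆
      ⁅v⁆∈Stratum₀ = ((v , x∈⁅x⁆ v) , q⊆p∪q τ ⁅ v ⁆ , ⁅v⁆≢σ , ⁅v⁆≢τ) , inj₁ (x∈⁅x⁆ v)
        where
          ⁅v⁆≢σ : ⁅ v ⁆ ≢ σ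
          ⁅v⁆≢σ ⁅v⁆≡σ = let (x , x∈τ) = τ-nonempty in
            v∉τ (subst (_∈ τ) (x∈⁅y⁆⇒x≡y v (subst (x ∈_) (sym ⁅v⁆≡σ) (p⊆p∪q ⁅ v ⁆ x∈τ))) x∈τ)
          ⁅v⁆≢τ : ⁅ v ⁆ ≢ τ
          ⁅v⁆≢τ ⁅v⁆≡τ = v∉τ (subst (v ∈_) ⁅v⁆≡τ (x∈⁅x⁆ v))

      Stratum₀-dismantlable : Dismantlable (Stratum 0)
      Stratum₀-dismantlable = cone-dismantlable (Stratum? 0) ⁅v⁆∈Stratum₀ apex
        where
          apex : ∀ h → Stratum 0 h → h ≢ ⁅ v ⁆ → ΓAdj ⁅ v ⁆ h
          apex h (_ , inj₁ v∈h) h≢⁅v⁆ = ≢-sym h≢⁅v⁆ , inj₁ (x∈p⇒⁅x⁆⊆p v∈h)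
          apex h (_ , inj₂ ())

      Stratum-stablyDominated : ∀ k → StablyDominated (Stratum k) (Stratum (suc k))
      Stratum-stablyDominated k M {h} Sₖ⊆M M⊆Sₖ₊₁ Mh h∉Sₖ = d , Md , d≢h , N[h]⊆N[d]
        where
          h∈∂ : BoundaryMinus σ τ h
          h∈∂ = proj₁ (M⊆Sₖ₊₁ Mh)

          v∉h : v ∉ h
          v∉h v∈h = h∉Sₖ (h∈∂ , inj₁ v∈h)

          h⊆τ : h ⊆ τ
          h⊆τ = ⊆-∪⁅⁆-cancel (proj₁ (proj₂ h∈∂)) v∉h

          d : Subset n
          d = h ∪ ⁅ v ⁆

          v∈d : v ∈ d
          v∈d = q⊆p∪q h ⁅ v ⁆ (x∈⁅x⁆ v)

          d≢σ : d ≢ σ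
          d≢σ d≡σ = proj₂ (proj₂ (proj₂ h∈∂))
            (⊆-antisym h⊆τ (⊆-∪⁅⁆-cancel (subst (τ ⊆_) (sym d≡σ) (p⊆p∪q ⁅ v ⁆)) v∉τ))

          Md : M d
          Md = Sₖ⊆M ( ((v , v∈d) , ∪⁅⁆-least (⊆-trans h⊆τ (p⊆p∪q ⁅ v ⁆)) v∈σ , d≢σ
                      , (λ d≡τ → v∉τ (subst (v ∈_) d≡τ v∈d)))
                    , inj₁ v∈d)

          d≢h : d ≢ h
          d≢h d≡h = v∉h (subst (v ∈_) d≡h v∈d)

          comparable : ∀ x → M x → x ≡ h ⊎ ΓAdj h x → d ⊆ x ⊎ x ⊆ d
          comparable x _  (inj₁ refl)            = inj₂ (p⊆p∪q ⁅ v ⁆)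
          comparable x _  (inj₂ (_ , inj₂ x⊆h))  = inj₂ (⊆-trans x⊆h (p⊆p∪q ⁅ v ⁆))
          comparable x Mx (inj₂ (h≢x , inj₁ h⊆x)) with proj₂ (M⊆Sₖ₊₁ Mx)
          ... | inj₁ v∈x = inj₁ (∪⁅⁆-least h⊆x v∈x)
          -- h ⊂ x with ∣ x ∣ ≤ k would put h in the stratum k.
          ... | inj₂ (s≤s ∣x∣≤k) =
            ⊥-elim (h∉Sₖ (h∈∂ , inj₂ (<-≤-trans (p⊂q⇒∣p∣<∣q∣ (⊆∧≢⇒⊂ h⊆x h≢x)) ∣x∣≤k)))

          N[h]⊆N[d] : ∀ x → M x → x ≡ h ⊎ ΓAdj h x → x ≡ d ⊎ ΓAdj d x
          N[h]⊆N[d] x Mx x∈N[h] with x ≟ d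
          ... | yes x≡d = inj₁ x≡d
          ... | no x≢d  = inj₂ (≢-sym x≢d , comparable x Mx x∈N[h])

      Stratum-dismantlable : ∀ k → Dismantlable (Stratum k)
      Stratum-dismantlable zero    = Stratum₀-dismantlable
      Stratum-dismantlable (suc k) =
        fill-dismantlable (Stratum? k) (Stratum? (suc k)) (Product.map₂ (Sum.map₂ m<n⇒m<1+n))
          (Stratum-stablyDominated k) (Stratum-dismantlable k)

    BoundaryMinus-dismantlable : Dismantlable (BoundaryMinus (τ ∪ ⁅ v ⁆) τ)
    BoundaryMinus-dismantlable =
      Dismantlable-cong (λ h → mk⇔ proj₁ (λ h∈∂ → h∈∂ , inj₂ (s≤s (∣p∣≤n h))))
        (Stratum-dismantlable (suc n))

  module ElementaryCollapseStep
    (K : SimplicialComplex n) {K′ : Graph} {σ τ : Subset n}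
    (Kσ : simplex K σ) (Kτ : simplex K τ) (τ⊆σ : τ ⊆ σ) (∣τ∣+1≡∣σ∣ : ∣ τ ∣ + 1 ≡ ∣ σ ∣)
    (only-σ : ∀ ρ → simplex K ρ → τ ⊂ ρ → ρ ≡ σ)
    (K′⇔ : ∀ ρ → K′ ρ ⇔ (simplex K ρ × ρ ≢ σ × ρ ≢ τ)) where

    τ≢σ : τ ≢ σ
    τ≢σ refl = m+1+n≢m ∣ τ ∣ ∣τ∣+1≡∣σ∣

    τ⊂σ : τ ⊂ σ
    τ⊂σ = ⊆∧≢⇒⊂ τ⊆σ τ≢σ

    v : Fin n
    v = proj₁ (proj₂ τ⊂σ)

    v∈σ : v ∈ σ
    v∈σ = proj₁ (proj₂ (proj₂ τ⊂σ))

    v∉τ : v ∉ τ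
    v∉τ = proj₂ (proj₂ (proj₂ τ⊂σ))

    σ≡τ∪⁅v⁆ : σ ≡ τ ∪ ⁅ v ⁆
    σ≡τ∪⁅v⁆ = sym (only-σ (τ ∪ ⁅ v ⁆)
      (down-closed K Kσ (∪⁅⁆-least τ⊆σ v∈σ) (v , v∈τ∪⁅v⁆))
      (p⊆p∪q ⁅ v ⁆ , v , v∈τ∪⁅v⁆ , v∉τ))
      where
        v∈τ∪⁅v⁆ : v ∈ τ ∪ ⁅ v ⁆
        v∈τ∪⁅v⁆ = q⊆p∪q τ ⁅ v ⁆ (x∈⁅x⁆ v)

    σ-maximal : ∀ ρ → simplex K ρ → σ ⊆ ρ → ρ ≡ σ
    σ-maximal ρ Kρ σ⊆ρ = only-σ ρ Kρ (⊂-⊆-trans τ⊂σ σ⊆ρ)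

    τ-removable : SDismantlable (Γ K) τ
    τ-removable = N-free-face-dismantlable (simplex? K) Kσ τ⊆σ τ≢σ only-σ

    N[σ]≃BoundaryMinus : N (Γ K ∖ τ) σ ≃ BoundaryMinus σ τ
    N[σ]≃BoundaryMinus h = mk⇔ N[σ]⇒ ⇒N[σ]
      where
        N[σ]⇒ : N (Γ K ∖ τ) σ h → BoundaryMinus σ τ h
        N[σ]⇒ ((Kh , h≢τ) , σ≢h , inj₁ σ⊆h) = ⊥-elim (σ≢h (sym (σ-maximal h Kh σ⊆h)))
        N[σ]⇒ ((Kh , h≢τ) , σ≢h , inj₂ h⊆σ) = nonempty K Kh , h⊆σ , ≢-sym σ≢h , h≢τ
        ⇒N[σ] : BoundaryMinus σ τ h → N (Γ K ∖ τ) σ h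
        ⇒N[σ] (h-nonempty , h⊆σ , h≢σ , h≢τ) =
          (down-closed K Kσ h⊆σ h-nonempty , h≢τ) , ≢-sym h≢σ , inj₂ h⊆σ

    σ-removable : SDismantlable (Γ K ∖ τ) σ
    σ-removable = Dismantlable-cong (≃-sym N[σ]≃BoundaryMinus)
      (subst (λ σ′ → Dismantlable (BoundaryMinus σ′ τ)) (sym σ≡τ∪⁅v⁆)
        (BoundaryMinus-dismantlable (nonempty K Kτ) v∉τ))

    ↘ˢ-collapse : ∀ {L} → K′ ↘ˢ L → Γ K ↘ˢ L
    ↘ˢ-collapse K′↘L =
      step τ Kτ τ-removable (step σ (Kσ , ≢-sym τ≢σ) σ-removable (↘ˢ-congˡ removed≃K′ K′↘L))
      where
        removed≃K′ : (Γ K ∖ τ) ∖ σ ≃ K′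
        removed≃K′ h = mk⇔ (λ { ((Kh , h≢τ) , h≢σ) → from (K′⇔ h) (Kh , h≢σ , h≢τ) })
                           (λ K′h → let (Kh , h≢σ , h≢τ) = to (K′⇔ h) K′h in (Kh , h≢τ) , h≢σ)

    K′-down-closed : ∀ {ρ π} → K′ ρ → π ⊆ ρ → Nonempty π → K′ π
    K′-down-closed {ρ} {π} K′ρ π⊆ρ π-nonempty =
      from (K′⇔ π) (down-closed K Kρ π⊆ρ π-nonempty , π≢σ , π≢τ)
      where
        Kρ : simplex K ρ
        Kρ = proj₁ (to (K′⇔ ρ) K′ρ)
        ρ≢σ : ρ ≢ σ
        ρ≢σ = proj₁ (proj₂ (to (K′⇔ ρ) K′ρ))
        π≢σ : π ≢ σ
        π≢σ refl = ρ≢σ (σ-maximal ρ Kρ π⊆ρ)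
        π≢τ : π ≢ τ
        π≢τ refl = ρ≢σ (only-σ ρ Kρ (⊆∧≢⇒⊂ π⊆ρ (≢-sym (proj₂ (proj₂ (to (K′⇔ ρ) K′ρ))))))

    collapsed : SimplicialComplex n
    collapsed = record
      { simplex     = K′
      ; simplex?    = λ ρ → map′ (from (K′⇔ ρ)) (to (K′⇔ ρ))
                              (simplex? K ρ ×-dec ¬? (ρ ≟ σ) ×-dec ¬? (ρ ≟ τ))
      ; nonempty    = λ K′ρ → nonempty K (proj₁ (to (K′⇔ _) K′ρ))
      ; down-closed = K′-down-closed
      }

  collapses-↘ˢ : (K : SimplicialComplex n) {L : Graph} → CollapsesP (simplex K) L → Γ K ↘ˢ L
  collapses-↘ˢ K (done K≃L) = done K≃L
  collapses-↘ˢ K (step (σ , τ , Kσ , Kτ , τ⊆σ , ∣τ∣+1≡∣σ∣ , only-σ , K′⇔) rest) =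
    ↘ˢ-collapse (collapses-↘ˢ collapsed rest)
    where open ElementaryCollapseStep K Kσ Kτ τ⊆σ ∣τ∣+1≡∣σ∣ only-σ K′⇔

proposition2p6 : ∀ {n} (K L : SimplicialComplex n) → K Collapses-onto L → ΓGraphs._↘ˢ_ n (Γ K) (Γ L)
proposition2p6 K L = collapses-↘ˢ K
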